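{- Let $G$ be a connected graph, let $f$ be an extremal $1$-color connection coloring of $G$ using colors $1,\dots,l$, and for each color $c$ let $T_c$ denote the subgraph formed by the edges of color $c$. Let $w$ be a vertex of degree $p$ in the complement graph $\overline G$. Then $$\sum_{T_c\in S}\big(m(T_c)-1\big)\ge p,\qquad\text{where } S=\{T_c : w\in V(T_c),\ c\in[l]\}.$$
   Context: All graphs are finite, simple and undirected; $m(H)$ is the number of edges of $H$. A $1$-color connection coloring of a connected graph $G$ is an edge-coloring such that every pair of distinct vertices is joined by a path all of whose edges have the same color (a monochromatic path). An extremal $1$-color connection coloring is such a coloring using the maximum possible number of colors, this maximum being the monochromatic connection number $mc(G)=cc_1(G)$. In an extremal $1$-color connection coloring each color class $T_c$ is a tree (a color tree). -}

module Defs where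

open import Data.Nat using (ℕ; zero; suc; _+_; _∸_; _≤_)
open import Data.Bool using (Bool; true; false; _∧_; if_then_else_; not)
open import Data.Fin using (Fin; _≟_; _<?_)
open import Data.List using (List; []; _∷_)
open import Data.Nat.ListAction using (sum)
open import Data.Bool.ListAction using (any)
open import Data.List.Relation.Unary.Unique.Propositional using (Unique)
open import Data.Product using (Σ; ∃; _×_; _,_)
open import Relation.Nullary using (¬_)
open import Relation.Nullary.Decidable using (⌊_⌋)
open import Relation.Binary.PropositionalEquality using (_≡_)
open import Data.List.Base using () renaming (tabulate to tabulateL)

record Graph (n : ℕ) : Set where
  field
    adj    : Fin n → Fin n → Bool
    sym    : ∀ u v → adj u v ≡ adj v u
    irrefl : ∀ u → adj u u ≡ false
open Graph public

ΣFin : (k : ℕ) → (Fin k → ℕ) → ℕ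
ΣFin k f = sum (tabulateL f)

ind : Bool → ℕ
ind true  = 1
ind false = 0

data Walk {n} (G : Graph n) : Fin n → Fin n → Set where
  []   : ∀ {u} → Walk G u u
  step : ∀ {u v w} → adj G u v ≡ true → Walk G v w → Walk G u w

Connected : ∀ {n} → Graph n → Set
Connected {n} G = ∀ (u v : Fin n) → Walk G u v

-- An edge-colouring with colours Fin l is a function on ordered pairs;
-- only its values on edges matter; it must be symmetric on edges.
EdgeColouring : ℕ → ℕ → Set
EdgeColouring n l = Fin n → Fin n → Fin l

data MonoWalk {n l} (G : Graph n) (col : EdgeColouring n l) (c : Fin l)
     : Fin n → Fin n → Set where
  []   : ∀ {u} → MonoWalk G col c u u
  step : ∀ {u v w} → adj G u v ≡ true → col u v ≡ c →
         MonoWalk G col c v w → MonoWalk G col c u w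

vertices : ∀ {n l} {G : Graph n} {col : EdgeColouring n l} {c : Fin l} {u v : Fin n}
           → MonoWalk G col c u v → List (Fin n)
vertices {v = v} []          = v ∷ []
vertices {u = u} (step _ _ p) = u ∷ vertices p

MonoPath : ∀ {n l} → Graph n → EdgeColouring n l → Fin l → Fin n → Fin n → Set
MonoPath G col c u v = Σ (MonoWalk G col c u v) λ p → Unique (vertices p)

record IsOneCC {n} (G : Graph n) (l : ℕ) (col : EdgeColouring n l) : Set where
  field
    symmetric : ∀ u v → adj G u v ≡ true → col u v ≡ col v u
    uses-all  : ∀ (c : Fin l) → ∃ λ u → ∃ λ v → adj G u v ≡ true × col u v ≡ c
    mono-conn : ∀ (u v : Fin n) → ¬ (u ≡ v) → ∃ λ c → MonoPath G col c u v

record IsExtremalOneCC {n} (G : Graph n) (l : ℕ) (col : EdgeColouring n l) : Set where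
  field
    oneCC   : IsOneCC G l col
    maximal : ∀ (l' : ℕ) (col' : EdgeColouring n l') → IsOneCC G l' col' → l' ≤ l

mT : ∀ {n l} → Graph n → EdgeColouring n l → Fin l → ℕ
mT {n} G col c =
  ΣFin n λ u → ΣFin n λ v → ind (⌊ u <? v ⌋ ∧ adj G u v ∧ ⌊ col u v ≟ c ⌋)

-- w ∈ V(T_c): w is incident to an edge of colour c
inT : ∀ {n l} → Graph n → EdgeColouring n l → Fin l → Fin n → Bool
inT {n} G col c w = any (λ v → adj G w v ∧ ⌊ col w v ≟ c ⌋) (tabulateL (λ v → v))

complDeg : ∀ {n} → Graph n → Fin n → ℕ
complDeg {n} G w = ΣFin n λ v → ind (not ⌊ w ≟ v ⌋ ∧ not (adj G w v))

sumS : ∀ {n l} → Graph n → EdgeColouring n l → Fin n → ℕ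
sumS {l = l} G col w =
  ΣFin l λ c → if inT G col c w then mT G col c ∸ 1 else 0

module Submission where

-- Lemma 4.5: if w has p co-neighbours (neighbours in the complement of
-- G), then Σ_{T_c ∋ w} (m(T_c) - 1) ≥ p.
--
-- Fix w and a colour c and grow the colour-c layers around w (layer k:
-- the vertices joined to w by a colour-c walk with at most k edges).
-- Each vertex v ≠ w of layer n enters at a definite round through an edge
-- from a vertex that entered earlier, a "parent" of v.  An edge is a
-- parent edge for at most one of its endpoints, so the parent counts sum
-- to at most m(T_c); a colour-c neighbour of w has a parent but is not a
-- co-neighbour, so at most m(T_c) - 1 co-neighbours lie in layer n (none
-- if w ∉ V(T_c)).  Every co-neighbour is joined to w by a monochromatic
-- path, which has fewer than n edges by pigeonhole, so it lies in layer n
-- of that colour; summing over the colours gives the bound.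

open import Defs hiding (sym)
open import Data.Nat using (ℕ; zero; suc; _+_; _∸_; _≤_; _<_; z≤n; s≤s)
open import Data.Nat.Properties
  using (+-mono-≤; +-mono-<; +-suc; +-identityʳ; ≤-trans; ≤-refl; ≤-reflexive;
         ≤-total; ≤⇒≯; ≰⇒>; <⇒≤; m≤m+n; m≤n+m; m<n⇒m<1+n; n<1+n; m≤n⇒m<n∨m≡n;
         ∸-monoˡ-≤; +-0-commutativeMonoid; module ≤-Reasoning)
  renaming (_≤?_ to _≤?ℕ_)
open import Data.Fin using (Fin; zero; suc; toℕ; fromℕ<; _≟_; _<?_)
open import Data.Fin.Properties using (<-cmp; <-irrefl; toℕ<n; toℕ-fromℕ<; pigeonhole)
open import Data.Bool using (Bool; true; false; _∧_; _∨_; not; if_then_else_)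
open import Data.Bool.Properties using (T-≡; ∨-zeroʳ; ∧-zeroʳ)
open import Data.Bool.ListAction using (any)
open import Data.List using (List; []; _∷_; length; lookup)
open import Data.List.Base using () renaming (tabulate to tabulateL)
open import Data.List.Relation.Unary.All as All using ()
open import Data.List.Relation.Unary.AllPairs using (_∷_)
open import Data.List.Relation.Unary.Any.Properties using (any⁺; any⁻; tabulate⁺; tabulate⁻)
open import Data.List.Relation.Unary.Unique.Propositional using (Unique)
open import Data.List.Membership.Propositional.Properties using (∈-lookup)
open import Data.Product using (∃; _×_; _,_; proj₁; proj₂; map₂)
open import Data.Sum using (_⊎_; inj₁; inj₂)
open import Data.Empty using (⊥; ⊥-elim)
open import Function.Bundles using (Equivalence)
open import Relation.Nullary using (¬_; yes; no)
open import Relation.Nullary.Decidable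
  using (Dec; ⌊_⌋; isYes≗does; dec-true; dec-false; toWitness)
open import Relation.Binary using (tri<; tri≈; tri>)
open import Relation.Binary.PropositionalEquality
  using (_≡_; refl; sym; trans; cong; cong₂; subst)
open import Algebra.Properties.CommutativeMonoid.Sum +-0-commutativeMonoid
  using (sum; sum-cong-≗; sum-replicate-zero; ∑-distrib-+; ∑-comm)

open Equivalence using (to; from)

ΣFin≡sum : ∀ n (f : Fin n → ℕ) → ΣFin n f ≡ sum f
ΣFin≡sum zero    f = refl
ΣFin≡sum (suc n) f = cong (f zero +_) (ΣFin≡sum n (λ i → f (suc i)))

Σ-cong : ∀ n {f g : Fin n → ℕ} → (∀ i → f i ≡ g i) → ΣFin n f ≡ ΣFin n g
Σ-cong n {f} {g} f≗g =
  trans (ΣFin≡sum n f) (trans (sum-cong-≗ f≗g) (sym (ΣFin≡sum n g)))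

Σ-zero : ∀ n → ΣFin n (λ _ → 0) ≡ 0
Σ-zero n = trans (ΣFin≡sum n _) (sum-replicate-zero n)

Σ-+ : ∀ n (f g : Fin n → ℕ) → ΣFin n (λ i → f i + g i) ≡ ΣFin n f + ΣFin n g
Σ-+ n f g = trans (ΣFin≡sum n _)
  (trans (∑-distrib-+ f g) (sym (cong₂ _+_ (ΣFin≡sum n f) (ΣFin≡sum n g))))

Σ-swap : ∀ m n (f : Fin m → Fin n → ℕ) →
  ΣFin m (λ i → ΣFin n (f i)) ≡ ΣFin n (λ j → ΣFin m (λ i → f i j))
Σ-swap m n f = trans (nested m n f) (trans (∑-comm f) (sym (nested n m (λ j i → f i j))))
  where
  nested : ∀ m n (f : Fin m → Fin n → ℕ) →
    ΣFin m (λ i → ΣFin n (f i)) ≡ sum (λ i → sum (f i))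
  nested m n f = trans (ΣFin≡sum m _) (sum-cong-≗ (λ i → ΣFin≡sum n (f i)))

Σ-mono : ∀ n {f g : Fin n → ℕ} → (∀ i → f i ≤ g i) → ΣFin n f ≤ ΣFin n g
Σ-mono zero    f≤g = z≤n
Σ-mono (suc n) f≤g = +-mono-≤ (f≤g zero) (Σ-mono n (λ i → f≤g (suc i)))

Σ-term : ∀ n (f : Fin n → ℕ) i → f i ≤ ΣFin n f
Σ-term (suc n) f zero    = m≤m+n (f zero) _
Σ-term (suc n) f (suc i) = ≤-trans (Σ-term n (λ j → f (suc j)) i) (m≤n+m _ (f zero))

Σ-strict : ∀ n {f g : Fin n → ℕ} → (∀ i → f i ≤ g i) → ∀ x → f x < g x →
  ΣFin n f < ΣFin n g
Σ-strict (suc n) f≤g zero    fx<gx = +-mono-≤ fx<gx (Σ-mono n (λ i → f≤g (suc i)))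
Σ-strict (suc n) {f} {g} f≤g (suc x) fx<gx =
  subst (_≤ ΣFin (suc n) g) (+-suc (f zero) _)
    (+-mono-≤ (f≤g zero) (Σ-strict n (λ i → f≤g (suc i)) x fx<gx))

ΣΣ : ∀ n → (Fin n → Fin n → ℕ) → ℕ
ΣΣ n a = ΣFin n (λ u → ΣFin n (a u))

halve : ∀ x y → x + x ≤ y + y → x ≤ y
halve x y x+x≤y+y with x ≤?ℕ y
... | yes x≤y = x≤y
... | no  x≰y = ⊥-elim (≤⇒≯ x+x≤y+y (+-mono-< (≰⇒> x≰y) (≰⇒> x≰y)))

ΣΣ-by-pairs : ∀ n (a b : Fin n → Fin n → ℕ) →
  (∀ u v → a u v + a v u ≤ b u v + b v u) → ΣΣ n a ≤ ΣΣ n b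
ΣΣ-by-pairs n a b pairs = halve (ΣΣ n a) (ΣΣ n b)
  (doubled (Σ-mono n (λ u → Σ-mono n (pairs u))))
  where
  twice : ∀ a → ΣΣ n (λ u v → a u v + a v u) ≡ ΣΣ n a + ΣΣ n a
  twice a = trans (Σ-cong n (λ u → Σ-+ n (a u) (λ v → a v u)))
    (trans (Σ-+ n (λ u → ΣFin n (a u)) (λ u → ΣFin n (λ v → a v u)))
           (cong (ΣΣ n a +_) (sym (Σ-swap n n a))))
  doubled : ΣΣ n (λ u v → a u v + a v u) ≤ ΣΣ n (λ u v → b u v + b v u) →
    ΣΣ n a + ΣΣ n a ≤ ΣΣ n b + ΣΣ n b
  doubled le = subst (_ ≤_) (twice b) (subst (_≤ _) (twice a) le)

∧-intro : ∀ {a b} → a ≡ true → b ≡ true → a ∧ b ≡ true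
∧-intro refl refl = refl

∧-elim : ∀ a b → a ∧ b ≡ true → a ≡ true × b ≡ true
∧-elim true true refl = refl , refl

∨-elim : ∀ a b → a ∨ b ≡ true → a ≡ true ⊎ b ≡ true
∨-elim true  b     _    = inj₁ refl
∨-elim false true  refl = inj₂ refl

not-true : ∀ b → not b ≡ true → b ≡ false
not-true false refl = refl

true≢false : ¬ true ≡ false
true≢false ()

⌊⌋-true : ∀ {A : Set} (a? : Dec A) → A → ⌊ a? ⌋ ≡ true
⌊⌋-true a? a = trans (isYes≗does a?) (dec-true a? a)

⌊⌋-false : ∀ {A : Set} (a? : Dec A) → ¬ A → ⌊ a? ⌋ ≡ false
⌊⌋-false a? ¬a = trans (isYes≗does a?) (dec-false a? ¬a)

⌊⌋-sound : ∀ {A : Set} (a? : Dec A) → ⌊ a? ⌋ ≡ true → A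
⌊⌋-sound a? holds = toWitness (from T-≡ holds)

any-intro : ∀ {m} (p : Fin m → Bool) i → p i ≡ true → any p (tabulateL (λ j → j)) ≡ true
any-intro p i pi = to T-≡ (any⁺ p (tabulate⁺ i (from T-≡ pi)))

any-elim : ∀ {m} (p : Fin m → Bool) → any p (tabulateL (λ j → j)) ≡ true → ∃ λ i → p i ≡ true
any-elim p anyp = map₂ (to T-≡) (tabulate⁻ (any⁻ p _ (from T-≡ anyp)))

-- An edge oriented by an antisymmetric relation is counted at most once ...
orient-once : ∀ e p q → (p ≡ true → q ≡ true → ⊥) → ind (e ∧ p) + ind (e ∧ q) ≤ ind e
orient-once false p     q     _    = z≤n
orient-once true  true  true  asym = ⊥-elim (asym refl refl)
orient-once true  true  false _    = ≤-refl
orient-once true  false true  _    = ≤-refl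
orient-once true  false false _    = z≤n

-- ... and is counted at least once by a total relation.
orient-total : ∀ e s t → (e ≡ true → s ∨ t ≡ true) → ind e ≤ ind (s ∧ e) + ind (t ∧ e)
orient-total false s     t     _     = z≤n
orient-total true  true  t     _     = s≤s z≤n
orient-total true  false true  _     = ≤-refl
orient-total true  false false total = ⊥-elim (true≢false (sym (total refl)))

lookup-injective : ∀ {A : Set} {xs : List A} → Unique xs →
  ∀ i j → lookup xs i ≡ lookup xs j → i ≡ j
lookup-injective (_  ∷ _)  zero    zero    _  = refl
lookup-injective (x∉ ∷ _)  zero    (suc j) eq = ⊥-elim (All.lookup x∉ (∈-lookup j) eq)
lookup-injective (x∉ ∷ _)  (suc i) zero    eq = ⊥-elim (All.lookup x∉ (∈-lookup i) (sym eq))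
lookup-injective (_  ∷ xs) (suc i) (suc j) eq = cong suc (lookup-injective xs i j eq)

unique-length : ∀ {n} (xs : List (Fin n)) → Unique xs → length xs ≤ n
unique-length {n} xs uniq with length xs ≤?ℕ n
... | yes short = short
... | no  long  with pigeonhole (≰⇒> long) (lookup xs)
...   | i , j , i<j , same = ⊥-elim (<-irrefl (lookup-injective uniq i j same) i<j)

walkLength : ∀ {n l} {G : Graph n} {col : EdgeColouring n l} {c : Fin l} {u v : Fin n} →
  MonoWalk G col c u v → ℕ
walkLength []           = 0
walkLength (step _ _ W) = suc (walkLength W)

vertices-length : ∀ {n l} {G : Graph n} {col : EdgeColouring n l} {c : Fin l} {u v : Fin n}
  (W : MonoWalk G col c u v) → length (vertices W) ≡ suc (walkLength W)
vertices-length []           = refl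
vertices-length (step _ _ W) = cong suc (vertices-length W)

path-short : ∀ {n l} {G : Graph n} {col : EdgeColouring n l} {c : Fin l} {u v : Fin n} →
  ((W , uniq) : MonoPath G col c u v) → walkLength W < n
path-short (W , uniq) = subst (_≤ _) (vertices-length W) (unique-length (vertices W) uniq)

coAdj : ∀ {n} → Graph n → Fin n → Fin n → Bool
coAdj G w v = not ⌊ w ≟ v ⌋ ∧ not (adj G w v)

coAdj⇒≢ : ∀ {n} (G : Graph n) w v → coAdj G w v ≡ true → ¬ w ≡ v
coAdj⇒≢ G w v co w≡v with ∧-elim (not ⌊ w ≟ v ⌋) _ co
... | distinct , _ = true≢false (trans (sym (⌊⌋-true (w ≟ v) w≡v)) (not-true _ distinct))

module ColourClass {n l} (G : Graph n) (col : EdgeColouring n l)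
                   (col-sym : ∀ u v → adj G u v ≡ true → col u v ≡ col v u)
                   (w : Fin n) (c : Fin l) where

  E : Fin n → Fin n → Bool
  E u v = adj G u v ∧ ⌊ col u v ≟ c ⌋

  E-elim : ∀ {u v} → E u v ≡ true → adj G u v ≡ true × col u v ≡ c
  E-elim {u} {v} uv with ∧-elim (adj G u v) _ uv
  ... | edge , coloured = edge , ⌊⌋-sound (col u v ≟ c) coloured

  E-sym : ∀ u v → E u v ≡ E v u
  E-sym u v rewrite Graph.sym G u v with adj G v u in vu
  ... | false = refl
  ... | true  rewrite col-sym u v (trans (Graph.sym G u v) vu) = refl

  -- an edge joins distinct vertices, so one of them is the smaller one
  E-ordered : ∀ u v → E u v ≡ true → ⌊ u <? v ⌋ ∨ ⌊ v <? u ⌋ ≡ true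
  E-ordered u v uv with <-cmp u v
  ... | tri< u<v _ _ rewrite ⌊⌋-true (u <? v) u<v = refl
  ... | tri> _ _ v<u rewrite ⌊⌋-true (v <? u) v<u = ∨-zeroʳ _
  ... | tri≈ _ refl _ =
    ⊥-elim (true≢false (trans (sym (proj₁ (∧-elim (adj G u u) _ uv))) (irrefl G u)))

  -- layer k: the vertices joined to w by a colour-c walk with at most k edges
  -- and `joins k v`: v has a colour-c edge from layer k
  layer : ℕ → Fin n → Bool
  joins : ℕ → Fin n → Bool
  layer zero    v = ⌊ w ≟ v ⌋
  layer (suc k) v = layer k v ∨ joins k v
  joins k v = any (λ u → layer k u ∧ E u v) (tabulateL (λ u → u))

  layer-suc : ∀ k v → layer k v ≡ true → layer (suc k) v ≡ true
  layer-suc k v inside rewrite inside = refl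

  layer-mono : ∀ {k j} v → k ≤ j → layer k v ≡ true → layer j v ≡ true
  layer-mono {j = zero}  v z≤n   inside = inside
  layer-mono {j = suc j} v k≤1+j inside with m≤n⇒m<n∨m≡n k≤1+j
  ... | inj₂ refl      = inside
  ... | inj₁ (s≤s k≤j) = layer-suc j v (layer-mono v k≤j inside)

  walk-layer : ∀ k {u v} (W : MonoWalk G col c u v) → layer k u ≡ true →
    layer (k + walkLength W) v ≡ true
  walk-layer k [] inside rewrite +-identityʳ k = inside
  walk-layer k {u} (step {v = x} ux ux-c W) inside rewrite +-suc k (walkLength W) =
    walk-layer (suc k) W next
    where
    next : layer (suc k) x ≡ true
    next rewrite any-intro (λ y → layer k y ∧ E y x) u
                   (∧-intro inside (∧-intro ux (⌊⌋-true (col u x ≟ c) ux-c))) = ∨-zeroʳ _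

  layer-suc-inv : ∀ k v → layer (suc k) v ≡ true →
    layer k v ≡ true ⊎ ∃ λ u → layer k u ≡ true × E u v ≡ true
  layer-suc-inv k v inside with ∨-elim (layer k v) _ inside
  ... | inj₁ earlier = inj₁ earlier
  ... | inj₂ new     = inj₂ (map₂ (∧-elim _ _) (any-elim _ new))

  entry : ∀ j v → layer j v ≡ true → layer 0 v ≡ false →
    ∃ λ k → k < j × layer k v ≡ false × layer (suc k) v ≡ true
  entry zero    v inside outside = ⊥-elim (true≢false (trans (sym inside) outside))
  entry (suc j) v inside outside with layer j v in before
  ... | true  with entry j v before outside
  ...   | k , k<j , out , into = k , m<n⇒m<1+n k<j , out , into
  entry (suc j) v inside outside | false =
    j , n<1+n j , before , subst (λ b → b ∨ joins j v ≡ true) (sym before) inside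

  stuck : inT G col c w ≡ false → ∀ k v → layer k v ≡ true → w ≡ v
  stuck isolated zero    v inside = ⌊⌋-sound (w ≟ v) inside
  stuck isolated (suc k) v inside with layer-suc-inv k v inside
  ... | inj₁ earlier          = stuck isolated k v earlier
  ... | inj₂ (u , u-in , uv) with stuck isolated k u u-in
  ...   | refl = ⊥-elim (true≢false (trans (sym (any-intro (E w) v uv)) isolated))

  ahead : Fin n → Fin n → Fin n → Bool
  ahead u v k = layer (toℕ k) u ∧ not (layer (toℕ k) v)

  precedes : Fin n → Fin n → Bool
  precedes u v = any (ahead u v) (tabulateL (λ k → k))

  -- layers are nested, so two vertices cannot precede each other
  precedes-asym : ∀ u v → precedes u v ≡ true → precedes v u ≡ true → ⊥
  precedes-asym u v uv vu with any-elim (ahead u v) uv | any-elim (ahead v u) vu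
  ... | i , at-i | j , at-j with ∧-elim (layer (toℕ i) u) _ at-i | ∧-elim (layer (toℕ j) v) _ at-j
  ...   | u-in , v-out | v-in , u-out with ≤-total (toℕ i) (toℕ j)
  ...     | inj₁ i≤j = true≢false (trans (sym (layer-mono u i≤j u-in)) (not-true _ u-out))
  ...     | inj₂ j≤i = true≢false (trans (sym (layer-mono v j≤i v-in)) (not-true _ v-out))

  parents : Fin n → ℕ
  parents v = ΣFin n (λ u → ind (E u v ∧ precedes u v))

  parent-exists : ∀ v → layer n v ≡ true → ¬ w ≡ v → 1 ≤ parents v
  parent-exists v inside w≢v with entry n v inside (⌊⌋-false (w ≟ v) w≢v)
  ... | k , k<n , out , into with layer-suc-inv k v into
  ...   | inj₁ in-k = ⊥-elim (true≢false (trans (sym in-k) out))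
  ...   | inj₂ (u , u-in , uv) =
    ≤-trans (≤-reflexive (cong ind (sym parent))) (Σ-term n (λ u → ind (E u v ∧ precedes u v)) u)
    where
    u-before-v : ahead u v (fromℕ< k<n) ≡ true
    u-before-v rewrite toℕ-fromℕ< k<n | u-in | out = refl
    parent : E u v ∧ precedes u v ≡ true
    parent = ∧-intro uv (any-intro (ahead u v) (fromℕ< k<n) u-before-v)

  -- each colour-c edge is the parent edge of at most one of its endpoints
  parents-total : ΣFin n parents ≤ mT G col c
  parents-total = subst (_≤ mT G col c) (Σ-swap n n child)
    (ΣΣ-by-pairs n child (λ u v → ind (⌊ u <? v ⌋ ∧ E u v)) pair)
    where
    child : Fin n → Fin n → ℕ
    child u v = ind (E u v ∧ precedes u v)
    pair : ∀ u v → child u v + child v u ≤ ind (⌊ u <? v ⌋ ∧ E u v) + ind (⌊ v <? u ⌋ ∧ E v u)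
    pair u v = begin
      child u v + child v u
        ≡⟨ cong (λ e → child u v + ind (e ∧ precedes v u)) (E-sym v u) ⟩
      ind (E u v ∧ precedes u v) + ind (E u v ∧ precedes v u)
        ≤⟨ orient-once (E u v) (precedes u v) (precedes v u) (precedes-asym u v) ⟩
      ind (E u v)
        ≤⟨ orient-total (E u v) ⌊ u <? v ⌋ ⌊ v <? u ⌋ (E-ordered u v) ⟩
      ind (⌊ u <? v ⌋ ∧ E u v) + ind (⌊ v <? u ⌋ ∧ E u v)
        ≡⟨ cong (λ e → ind (⌊ u <? v ⌋ ∧ E u v) + ind (⌊ v <? u ⌋ ∧ e)) (E-sym u v) ⟩
      ind (⌊ u <? v ⌋ ∧ E u v) + ind (⌊ v <? u ⌋ ∧ E v u) ∎
      where open ≤-Reasoning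

  reachedCoNbrs : ℕ
  reachedCoNbrs = ΣFin n (λ v → ind (layer n v ∧ coAdj G w v))

  -- if w ∉ V(T_c), the layers stay {w}, so no co-neighbour is reached
  none-reached : inT G col c w ≡ false → reachedCoNbrs ≤ 0
  none-reached isolated = subst (reachedCoNbrs ≤_) (Σ-zero n) (Σ-mono n none)
    where
    none : ∀ v → ind (layer n v ∧ coAdj G w v) ≤ 0
    none v with layer n v in inside
    ... | false = z≤n
    ... | true rewrite stuck isolated n v inside | ⌊⌋-true (v ≟ v) refl = z≤n

  -- if w ∈ V(T_c), every reached co-neighbour has a parent, and so does a
  -- colour-c neighbour x of w, which is not a co-neighbour
  fewer-than-parents : inT G col c w ≡ true → reachedCoNbrs < ΣFin n parents
  fewer-than-parents incident with any-elim (E w) incident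
  ... | x , wx = Σ-strict n has-parent x
                   (subst (_< parents x) (sym x-not-co) (parent-exists x x-in w≢x))
    where
    has-parent : ∀ v → ind (layer n v ∧ coAdj G w v) ≤ parents v
    has-parent v with layer n v ∧ coAdj G w v in reached
    ... | false = z≤n
    ... | true with ∧-elim (layer n v) _ reached
    ...   | inside , co = parent-exists v inside (coAdj⇒≢ G w v co)
    w-x : adj G w x ≡ true × col w x ≡ c
    w-x = E-elim wx
    w≢x : ¬ w ≡ x
    w≢x refl = true≢false (trans (sym (proj₁ w-x)) (irrefl G w))
    x-in : layer n x ≡ true
    x-in = layer-mono x (≤-trans (s≤s z≤n) (toℕ<n w))
             (walk-layer 0 (step (proj₁ w-x) (proj₂ w-x) []) (⌊⌋-true (w ≟ w) refl))
    x-not-co : ind (layer n x ∧ coAdj G w x) ≡ 0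
    x-not-co rewrite proj₁ w-x | ∧-zeroʳ (not ⌊ w ≟ x ⌋) | ∧-zeroʳ (layer n x) = refl

  colour-bound : reachedCoNbrs ≤ (if inT G col c w then mT G col c ∸ 1 else 0)
  colour-bound with inT G col c w in incident
  ... | false = none-reached incident
  ... | true  = ∸-monoˡ-≤ 1 (≤-trans (fewer-than-parents incident) parents-total)

-- In a 1-colour connection colouring every co-neighbour v of w is reached
-- in the colour of a monochromatic w–v path.
coNbr-reached : ∀ {n l} (G : Graph n) (col : EdgeColouring n l) (oneCC : IsOneCC G l col) w v →
  ind (coAdj G w v) ≤
  ΣFin l (λ c → ind (ColourClass.layer G col (IsOneCC.symmetric oneCC) w c n v ∧ coAdj G w v))
coNbr-reached {n} G col oneCC w v with coAdj G w v in co
... | false = z≤n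
... | true with IsOneCC.mono-conn oneCC w v (coAdj⇒≢ G w v co)
...   | c , path@(W , _) = ≤-trans (≤-reflexive (cong ind (sym v-in))) (Σ-term _ _ c)
  where
  open ColourClass G col (IsOneCC.symmetric oneCC) w c
  v-in : layer n v ∧ true ≡ true
  v-in = ∧-intro (layer-mono v (<⇒≤ (path-short path)) (walk-layer 0 W (⌊⌋-true (w ≟ w) refl))) refl

lemma4p5 : ∀ (n : ℕ) (G : Graph n) → Connected G →
    ∀ (l : ℕ) (f : EdgeColouring n l) → IsExtremalOneCC G l f →
    ∀ (w : Fin n) (p : ℕ) → complDeg G w ≡ p → p ≤ sumS G f w
lemma4p5 n G _ l f extremal w .(complDeg G w) refl = begin
  complDeg G w
    ≤⟨ Σ-mono n (coNbr-reached G f oneCC w) ⟩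
  ΣFin n (λ v → ΣFin l (λ c → ind (layer c n v ∧ coAdj G w v)))
    ≡⟨ Σ-swap n l _ ⟩
  ΣFin l (λ c → reachedCoNbrs c)
    ≤⟨ Σ-mono l colour-bound ⟩
  sumS G f w ∎
  where
  open ≤-Reasoning
  oneCC = IsExtremalOneCC.oneCC extremal
  open ColourClass G f (IsOneCC.symmetric oneCC) w using (layer; reachedCoNbrs; colour-bound)
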